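{- Let $G$ be a finite simple graph that is $\{K_{1,3}, H_1, H_2\}$-free, let $v \in V(G)$, and let $Q_v$ be (the vertex set of) a maximum clique in the subgraph induced by $N(v)$. Then one of the following holds: (1) the subgraph induced by $N(v)\setminus Q_v$ is complete; or (2) $N(v)\setminus Q_v = \{w, z\}$ with $wz \notin E(G)$, and there exist $w', z' \in Q_v$ such that $ww', zz' \notin E(G)$, $zq \in E(G)$ for all $q \in Q_v\setminus\{z'\}$, and $wq \in E(G)$ for all $q \in Q_v\setminus\{w'\}$; or (3) $N(v)\setminus Q_v = \{w, z, x\}$ with $xz, xw \in E(G)$ and $wz \notin E(G)$, and there exist $w', z' \in Q_v$ such that $ww', zz', xw', xz' \notin E(G)$, $wq \in E(G)$ for all $q \in Q_v\setminus\{w'\}$, $zq \in E(G)$ for all $q \in Q_v\setminus\{z'\}$, and $xq \in E(G)$ for all $q \in Q_v\setminus\{w', z'\}$.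
   Context: All graphs are finite and simple. $N(v)=\{u\in V(G): uv\in E(G)\}$. $G$ is $\mathcal{F}$-free if $G$ has no induced subgraph isomorphic to any member of $\mathcal{F}$. $K_{1,3}$ is the claw. $H_1$ is the 5-vertex graph on vertices $a,b,c,d,e$ with edge set $\{ab, ac, ad, bc, bd, ce\}$ (a diamond on $a,b,c,d$ missing $cd$, plus a pendant vertex $e$ adjacent only to $c$). $H_2$ is the 5-vertex graph on vertices $a,b,c,d,e$ with edge set $\{ac, ad, ae, bd, be, cd, ce\}$, i.e. the complement of the disjoint union of a path on three vertices $a$–$b$–$c$ and an edge $de$. -}

module Defs where

open import Data.Nat using (ℕ; _≤_)
open import Data.Fin using (Fin; zero; suc)
open import Data.Fin.Subset using (Subset; _∈_; _∉_; ∣_∣)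
open import Data.Bool using (Bool; true; false; T)
open import Data.Product using (Σ; _×_; _,_; ∃-syntax)
open import Data.Sum using (_⊎_)
open import Relation.Nullary using (¬_; Dec)
open import Relation.Binary.PropositionalEquality using (_≡_; _≢_)
open import Function.Bundles using (_⇔_)
open import Function.Definitions using (Injective)

record Graph (n : ℕ) : Set₁ where
  field
    E      : Fin n → Fin n → Set
    E-dec  : ∀ x y → Dec (E x y)
    E-sym  : ∀ {x y} → E x y → E y x
    E-irr  : ∀ x → ¬ E x x
open Graph public

InducedCopy : ∀ {k n} → Graph k → Graph n → Set
InducedCopy {k} {n} H G =
  Σ (Fin k → Fin n) λ f → Injective _≡_ _≡_ f × (∀ i j → E H i j ⇔ E G (f i) (f j))

module Pattern {k : ℕ} (e : Fin k → Fin k → Bool)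
         (e-sym : ∀ i j → e i j ≡ e j i) (e-irr : ∀ i → e i i ≡ false) where
  open import Data.Bool using (T?)
  open import Relation.Binary.PropositionalEquality using (subst; sym)
  open import Data.Bool.Properties using ()
  graph : Graph k
  graph = record
    { E = λ i j → T (e i j)
    ; E-dec = λ i j → T? (e i j)
    ; E-sym = λ {i} {j} t → subst T (e-sym i j) t
    ; E-irr = λ i t → subst T (e-irr i) t
    }

-- vertex names a=0, b=1, c=2, d=3, e=4

clawE : Fin 4 → Fin 4 → Bool
clawE zero (suc _) = true
clawE (suc _) zero = true
clawE _ _ = false

-- H1: edges ab, ac, ad, bc, bd, ce
h1E : Fin 5 → Fin 5 → Bool
h1E zero (suc zero) = true
h1E zero (suc (suc zero)) = true
h1E zero (suc (suc (suc zero))) = true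
h1E (suc zero) (suc (suc zero)) = true
h1E (suc zero) (suc (suc (suc zero))) = true
h1E (suc (suc zero)) (suc (suc (suc (suc zero)))) = true
h1E (suc zero) zero = true
h1E (suc (suc zero)) zero = true
h1E (suc (suc (suc zero))) zero = true
h1E (suc (suc zero)) (suc zero) = true
h1E (suc (suc (suc zero))) (suc zero) = true
h1E (suc (suc (suc (suc zero)))) (suc (suc zero)) = true
h1E _ _ = false

-- H2: edges ac, ad, ae, bd, be, cd, ce
h2E : Fin 5 → Fin 5 → Bool
h2E zero (suc (suc zero)) = true
h2E zero (suc (suc (suc zero))) = true
h2E zero (suc (suc (suc (suc zero)))) = true
h2E (suc zero) (suc (suc (suc zero))) = true
h2E (suc zero) (suc (suc (suc (suc zero)))) = true
h2E (suc (suc zero)) (suc (suc (suc zero))) = true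
h2E (suc (suc zero)) (suc (suc (suc (suc zero)))) = true
h2E (suc (suc zero)) zero = true
h2E (suc (suc (suc zero))) zero = true
h2E (suc (suc (suc (suc zero)))) zero = true
h2E (suc (suc (suc zero))) (suc zero) = true
h2E (suc (suc (suc (suc zero)))) (suc zero) = true
h2E (suc (suc (suc zero))) (suc (suc zero)) = true
h2E (suc (suc (suc (suc zero)))) (suc (suc zero)) = true
h2E _ _ = false

open import Relation.Binary.PropositionalEquality using (refl)

clawSym : ∀ i j → clawE i j ≡ clawE j i
clawSym zero zero = refl
clawSym zero (suc j) = refl
clawSym (suc i) zero = refl
clawSym (suc i) (suc j) = refl

clawIrr : ∀ i → clawE i i ≡ false
clawIrr zero = refl
clawIrr (suc i) = refl

h1Sym : ∀ i j → h1E i j ≡ h1E j i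
h1Sym zero zero = refl
h1Sym zero (suc zero) = refl
h1Sym zero (suc (suc zero)) = refl
h1Sym zero (suc (suc (suc zero))) = refl
h1Sym zero (suc (suc (suc (suc zero)))) = refl
h1Sym (suc zero) zero = refl
h1Sym (suc zero) (suc zero) = refl
h1Sym (suc zero) (suc (suc zero)) = refl
h1Sym (suc zero) (suc (suc (suc zero))) = refl
h1Sym (suc zero) (suc (suc (suc (suc zero)))) = refl
h1Sym (suc (suc zero)) zero = refl
h1Sym (suc (suc zero)) (suc zero) = refl
h1Sym (suc (suc zero)) (suc (suc zero)) = refl
h1Sym (suc (suc zero)) (suc (suc (suc zero))) = refl
h1Sym (suc (suc zero)) (suc (suc (suc (suc zero)))) = refl
h1Sym (suc (suc (suc zero))) zero = refl
h1Sym (suc (suc (suc zero))) (suc zero) = refl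
h1Sym (suc (suc (suc zero))) (suc (suc zero)) = refl
h1Sym (suc (suc (suc zero))) (suc (suc (suc zero))) = refl
h1Sym (suc (suc (suc zero))) (suc (suc (suc (suc zero)))) = refl
h1Sym (suc (suc (suc (suc zero)))) zero = refl
h1Sym (suc (suc (suc (suc zero)))) (suc zero) = refl
h1Sym (suc (suc (suc (suc zero)))) (suc (suc zero)) = refl
h1Sym (suc (suc (suc (suc zero)))) (suc (suc (suc zero))) = refl
h1Sym (suc (suc (suc (suc zero)))) (suc (suc (suc (suc zero)))) = refl

h2Sym : ∀ i j → h2E i j ≡ h2E j i
h2Sym zero zero = refl
h2Sym zero (suc zero) = refl
h2Sym zero (suc (suc zero)) = refl
h2Sym zero (suc (suc (suc zero))) = refl
h2Sym zero (suc (suc (suc (suc zero)))) = refl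
h2Sym (suc zero) zero = refl
h2Sym (suc zero) (suc zero) = refl
h2Sym (suc zero) (suc (suc zero)) = refl
h2Sym (suc zero) (suc (suc (suc zero))) = refl
h2Sym (suc zero) (suc (suc (suc (suc zero)))) = refl
h2Sym (suc (suc zero)) zero = refl
h2Sym (suc (suc zero)) (suc zero) = refl
h2Sym (suc (suc zero)) (suc (suc zero)) = refl
h2Sym (suc (suc zero)) (suc (suc (suc zero))) = refl
h2Sym (suc (suc zero)) (suc (suc (suc (suc zero)))) = refl
h2Sym (suc (suc (suc zero))) zero = refl
h2Sym (suc (suc (suc zero))) (suc zero) = refl
h2Sym (suc (suc (suc zero))) (suc (suc zero)) = refl
h2Sym (suc (suc (suc zero))) (suc (suc (suc zero))) = refl
h2Sym (suc (suc (suc zero))) (suc (suc (suc (suc zero)))) = refl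
h2Sym (suc (suc (suc (suc zero)))) zero = refl
h2Sym (suc (suc (suc (suc zero)))) (suc zero) = refl
h2Sym (suc (suc (suc (suc zero)))) (suc (suc zero)) = refl
h2Sym (suc (suc (suc (suc zero)))) (suc (suc (suc zero))) = refl
h2Sym (suc (suc (suc (suc zero)))) (suc (suc (suc (suc zero)))) = refl

h1Irr : ∀ i → h1E i i ≡ false
h1Irr zero = refl
h1Irr (suc zero) = refl
h1Irr (suc (suc zero)) = refl
h1Irr (suc (suc (suc zero))) = refl
h1Irr (suc (suc (suc (suc zero)))) = refl

h2Irr : ∀ i → h2E i i ≡ false
h2Irr zero = refl
h2Irr (suc zero) = refl
h2Irr (suc (suc zero)) = refl
h2Irr (suc (suc (suc zero))) = refl
h2Irr (suc (suc (suc (suc zero)))) = refl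

Claw : Graph 4
Claw = Pattern.graph clawE clawSym clawIrr

H₁ : Graph 5
H₁ = Pattern.graph h1E h1Sym h1Irr

H₂ : Graph 5
H₂ = Pattern.graph h2E h2Sym h2Irr

ClawH1H2Free : ∀ {n} → Graph n → Set
ClawH1H2Free G = ¬ InducedCopy Claw G × ¬ InducedCopy H₁ G × ¬ InducedCopy H₂ G

IsClique : ∀ {n} → Graph n → Subset n → Set
IsClique G Q = ∀ x y → x ∈ Q → y ∈ Q → x ≢ y → E G x y

InNbhd : ∀ {n} → Graph n → Fin n → Subset n → Set
InNbhd G v Q = ∀ x → x ∈ Q → E G v x

IsMaxCliqueInNbhd : ∀ {n} → Graph n → Fin n → Subset n → Set
IsMaxCliqueInNbhd G v Q =
  InNbhd G v Q × IsClique G Q ×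
  (∀ Q′ → InNbhd G v Q′ → IsClique G Q′ → ∣ Q′ ∣ ≤ ∣ Q ∣)

InRest : ∀ {n} → Graph n → Fin n → Subset n → Fin n → Set
InRest G v Q u = E G v u × u ∉ Q

-- Let R = N(v) ∖ Q. Maximality of Q gives an exchange principle: a clique A ⊆ N(v) complete to
-- Q ∖ D has ∣A∣ ≤ ∣D∣, because (Q ∖ D) ∪ A is again a clique of N(v). So every vertex of N(v)
-- misses a vertex of Q, no edge of N(v) is complete to Q minus one vertex, and no triangle is
-- complete to Q minus two. If R is not a clique, pick non-adjacent w, z ∈ R and non-neighbours
-- w′, z′ ∈ Q of them. Claw-freeness at v and H₁-freeness make w′, z′ the only non-neighbours of
-- w, z in Q and every further x ∈ R adjacent to w and z; H₂ and H₁ make such x complete to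
-- Q ∖ {w′, z′}; exchange then forces xw′, xz′ ∉ E and rules out a second such vertex x′, as
-- w, x, x′ would be a triangle complete to Q ∖ {w′, z′}.
module Submission where

open import Defs
open import Data.Bool using (Bool; true; false; T)
open import Data.Empty using (⊥; ⊥-elim)
open import Data.Fin using (Fin; zero; suc; _≟_)
open import Data.Fin.Properties using (any?)
open import Data.Fin.Subset
  using (Subset; _∈_; _∉_; _⊆_; ∣_∣; _∪_; _∩_; _─_; ⁅_⁆; Empty; inside; outside)
  renaming (⊥ to ∅)
open import Data.Fin.Subset.Properties
  using (_∈?_; ∣⊥∣≡0; ∣⁅x⁆∣≡1; p⊆q⇒∣p∣≤∣q∣; Empty-unique; x∈⁅y⁆⇒x≡y; x∉⁅y⁆⇒x≢y;
         x∈p∪q⁻; x∈p∪q⁺; x∈p∩q⁻; x∈p∧x∉q⇒x∈p─q; p─q⊆p; drop-there)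
open import Data.Nat using (suc; _+_; _≤_)
open import Data.Nat.Properties
  using (+-suc; +-identityʳ; m≤m+n; +-cancelʳ-≤; ≤-trans; 1+n≰n; module ≤-Reasoning)
import Data.Product as Product
open import Data.Product using (_×_; ∃-syntax; _,_; proj₁; proj₂)
open import Data.Sum using (_⊎_; inj₁; inj₂; [_,_]′)
open import Data.Unit using (⊤; tt)
open import Data.Vec.Base using (Vec; []; _∷_; lookup; here; there)
open import Function using (_∘_; case_of_)
open import Function.Bundles using (_⇔_; mk⇔)
open import Function.Definitions using (Injective)
open import Relation.Nullary using (¬_; Dec; yes; no)
open import Relation.Nullary.Decidable using (_×-dec_; ¬?; decidable-stable)
open import Relation.Binary.PropositionalEquality
  using (_≡_; _≢_; refl; sym; trans; cong; cong₂; subst; subst₂; module ≡-Reasoning)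

∣p∪q∣+∣p∩q∣≡∣p∣+∣q∣ : ∀ {m} (p q : Subset m) → ∣ p ∪ q ∣ + ∣ p ∩ q ∣ ≡ ∣ p ∣ + ∣ q ∣
∣p∪q∣+∣p∩q∣≡∣p∣+∣q∣ [] [] = refl
∣p∪q∣+∣p∩q∣≡∣p∣+∣q∣ (inside ∷ p) (inside ∷ q) =
  cong suc (trans (+-suc _ _) (trans (cong suc (∣p∪q∣+∣p∩q∣≡∣p∣+∣q∣ p q)) (sym (+-suc _ _))))
∣p∪q∣+∣p∩q∣≡∣p∣+∣q∣ (inside ∷ p) (outside ∷ q) = cong suc (∣p∪q∣+∣p∩q∣≡∣p∣+∣q∣ p q)
∣p∪q∣+∣p∩q∣≡∣p∣+∣q∣ (outside ∷ p) (inside ∷ q) =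
  trans (cong suc (∣p∪q∣+∣p∩q∣≡∣p∣+∣q∣ p q)) (sym (+-suc _ _))
∣p∪q∣+∣p∩q∣≡∣p∣+∣q∣ (outside ∷ p) (outside ∷ q) = ∣p∪q∣+∣p∩q∣≡∣p∣+∣q∣ p q

∣p∪q∣≤∣p∣+∣q∣ : ∀ {m} (p q : Subset m) → ∣ p ∪ q ∣ ≤ ∣ p ∣ + ∣ q ∣
∣p∪q∣≤∣p∣+∣q∣ p q = subst (∣ p ∪ q ∣ ≤_) (∣p∪q∣+∣p∩q∣≡∣p∣+∣q∣ p q) (m≤m+n _ _)

Empty[p∩q]⇒∣p∪q∣≡∣p∣+∣q∣ : ∀ {m} (p q : Subset m) → Empty (p ∩ q) → ∣ p ∪ q ∣ ≡ ∣ p ∣ + ∣ q ∣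
Empty[p∩q]⇒∣p∪q∣≡∣p∣+∣q∣ {m} p q disjoint = begin
  ∣ p ∪ q ∣               ≡⟨ +-identityʳ _ ⟨
  ∣ p ∪ q ∣ + 0           ≡⟨ cong (∣ p ∪ q ∣ +_) ∣p∩q∣≡0 ⟨
  ∣ p ∪ q ∣ + ∣ p ∩ q ∣   ≡⟨ ∣p∪q∣+∣p∩q∣≡∣p∣+∣q∣ p q ⟩
  ∣ p ∣ + ∣ q ∣           ∎
  where
    open ≡-Reasoning
    ∣p∩q∣≡0 : ∣ p ∩ q ∣ ≡ 0
    ∣p∩q∣≡0 = trans (cong ∣_∣ (Empty-unique disjoint)) (∣⊥∣≡0 m)

x∈p─q⁻ : ∀ {m} {x : Fin m} (p q : Subset m) → x ∈ p ─ q → x ∈ p × x ∉ q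
x∈p─q⁻ (inside ∷ p) (outside ∷ q) here = here , λ ()
x∈p─q⁻ (_ ∷ p) (inside ∷ q) (there x∈p─q) =
  Product.map there (λ x∉q → x∉q ∘ drop-there) (x∈p─q⁻ p q x∈p─q)
x∈p─q⁻ (_ ∷ p) (outside ∷ q) (there x∈p─q) =
  Product.map there (λ x∉q → x∉q ∘ drop-there) (x∈p─q⁻ p q x∈p─q)

∀∈-⁅⁆ : ∀ {m} {P : Fin m → Set} {a} → P a → ∀ x → x ∈ ⁅ a ⁆ → P x
∀∈-⁅⁆ {P = P} {a} Pa x x∈⁅a⁆ = subst P (sym (x∈⁅y⁆⇒x≡y a x∈⁅a⁆)) Pa

∀∈-∪ : ∀ {m} {P : Fin m → Set} {p q} →
       (∀ x → x ∈ p → P x) → (∀ x → x ∈ q → P x) → ∀ x → x ∈ p ∪ q → P x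
∀∈-∪ {p = p} {q} Pp Pq x x∈p∪q = [ Pp x , Pq x ]′ (x∈p∪q⁻ p q x∈p∪q)

p⊆q∪[p─q] : ∀ {m} (p q : Subset m) → p ⊆ q ∪ (p ─ q)
p⊆q∪[p─q] p q {x} x∈p with x ∈? q
... | yes x∈q = x∈p∪q⁺ (inj₁ x∈q)
... | no  x∉q = x∈p∪q⁺ (inj₂ (x∈p∧x∉q⇒x∈p─q x∈p x∉q))

∣p∣≤∣q∣+∣p─q∣ : ∀ {m} (p q : Subset m) → ∣ p ∣ ≤ ∣ q ∣ + ∣ p ─ q ∣
∣p∣≤∣q∣+∣p─q∣ p q = ≤-trans (p⊆q⇒∣p∣≤∣q∣ (p⊆q∪[p─q] p q)) (∣p∪q∣≤∣p∣+∣q∣ q (p ─ q))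

module _ {n} (G : Graph n) where

  E-stable : ∀ x y → ¬ ¬ E G x y → E G x y
  E-stable x y = decidable-stable (E-dec G x y)

  edge⇒≢ : ∀ {x y} → E G x y → x ≢ y
  edge⇒≢ xy refl = E-irr G _ xy

  Complete : Subset n → Subset n → Set
  Complete p q = ∀ x → x ∈ p → ∀ y → y ∈ q → E G x y

  complete⇒∣p∪q∣≡∣p∣+∣q∣ : ∀ {p q} → Complete p q → ∣ p ∪ q ∣ ≡ ∣ p ∣ + ∣ q ∣
  complete⇒∣p∪q∣≡∣p∣+∣q∣ {p} {q} p~q = Empty[p∩q]⇒∣p∪q∣≡∣p∣+∣q∣ p q λ where
    (x , x∈p∩q) → E-irr G x (p~q x (proj₁ (x∈p∩q⁻ p q x∈p∩q)) x (proj₂ (x∈p∩q⁻ p q x∈p∩q)))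

  ⁅⁆-clique : ∀ x → IsClique G ⁅ x ⁆
  ⁅⁆-clique x y z y∈⁅x⁆ z∈⁅x⁆ y≢z =
    ⊥-elim (y≢z (trans (x∈⁅y⁆⇒x≡y x y∈⁅x⁆) (sym (x∈⁅y⁆⇒x≡y x z∈⁅x⁆))))

  ∪-clique : ∀ {p q} → IsClique G p → IsClique G q → Complete p q → IsClique G (p ∪ q)
  ∪-clique {p} {q} p-clique q-clique p~q x y x∈ y∈ x≢y with x∈p∪q⁻ p q x∈ | x∈p∪q⁻ p q y∈
  ... | inj₁ x∈p | inj₁ y∈p = p-clique x y x∈p y∈p x≢y
  ... | inj₁ x∈p | inj₂ y∈q = p~q x x∈p y y∈q
  ... | inj₂ x∈q | inj₁ y∈p = E-sym G (p~q y y∈p x x∈q)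
  ... | inj₂ x∈q | inj₂ y∈q = q-clique x y x∈q y∈q x≢y

  Adjacency : Bool → Fin n → Fin n → Set
  Adjacency true  x y = E G x y
  Adjacency false x y = ¬ E G x y × x ≢ y

  adjacency-≢ : ∀ b {x y} → Adjacency b x y → x ≢ y
  adjacency-≢ true  = edge⇒≢
  adjacency-≢ false = proj₂

  adjacency-sym : ∀ b {x y} → Adjacency b x y → Adjacency b y x
  adjacency-sym true  = E-sym G
  adjacency-sym false (¬xy , x≢y) = ¬xy ∘ E-sym G , x≢y ∘ sym

  adjacency⇒⇔ : ∀ b {x y} → Adjacency b x y → T b ⇔ E G x y
  adjacency⇒⇔ true  xy       = mk⇔ (λ _ → xy) (λ _ → tt)
  adjacency⇒⇔ false (¬xy , _) = mk⇔ (λ ()) ¬xy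

  Row : ∀ {k} → (Fin k → Bool) → Fin n → Vec (Fin n) k → Set
  Row b x []       = ⊤
  Row b x (y ∷ ys) = Adjacency (b zero) x y × Row (b ∘ suc) x ys

  -- The upper triangle of the adjacency table e, read off row by row.
  Realises : ∀ {k} → (Fin k → Fin k → Bool) → Vec (Fin n) k → Set
  Realises e []       = ⊤
  Realises e (x ∷ xs) = Row (e zero ∘ suc) x xs × Realises (λ i j → e (suc i) (suc j)) xs

  row-lookup : ∀ {k} b x (ys : Vec (Fin n) k) → Row b x ys → ∀ j → Adjacency (b j) x (lookup ys j)
  row-lookup b x (y ∷ ys) (xy , _)  zero    = xy
  row-lookup b x (y ∷ ys) (_ , row) (suc j) = row-lookup (b ∘ suc) x ys row j

  realises⇒injective : ∀ {k} e (xs : Vec (Fin n) k) → Realises e xs → Injective _≡_ _≡_ (lookup xs)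
  realises⇒injective e (x ∷ xs) _ {zero} {zero} _ = refl
  realises⇒injective e (x ∷ xs) (row , _) {zero} {suc j} eq =
    ⊥-elim (adjacency-≢ (e zero (suc j)) (row-lookup _ x xs row j) eq)
  realises⇒injective e (x ∷ xs) (row , _) {suc i} {zero} eq =
    ⊥-elim (adjacency-≢ (e zero (suc i)) (row-lookup _ x xs row i) (sym eq))
  realises⇒injective e (x ∷ xs) (_ , rest) {suc i} {suc j} eq =
    cong suc (realises⇒injective _ xs rest eq)

  realises⇒⇔ : ∀ {k} e → (∀ i j → e i j ≡ e j i) → (∀ i → e i i ≡ false) →
               (xs : Vec (Fin n) k) → Realises e xs →
               ∀ i j → T (e i j) ⇔ E G (lookup xs i) (lookup xs j)
  realises⇒⇔ e _ e-irr (x ∷ xs) _ zero zero =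
    mk⇔ (λ t → ⊥-elim (subst T (e-irr zero) t)) (λ xx → ⊥-elim (E-irr G x xx))
  realises⇒⇔ e _ _ (x ∷ xs) (row , _) zero (suc j) =
    adjacency⇒⇔ (e zero (suc j)) (row-lookup _ x xs row j)
  realises⇒⇔ e e-sym _ (x ∷ xs) (row , _) (suc i) zero =
    subst (λ b → T b ⇔ E G (lookup xs i) x) (e-sym zero (suc i))
      (adjacency⇒⇔ b (adjacency-sym b (row-lookup _ x xs row i)))
    where b = e zero (suc i)
  realises⇒⇔ e e-sym e-irr (x ∷ xs) (_ , rest) (suc i) (suc j) =
    realises⇒⇔ _ (λ i j → e-sym (suc i) (suc j)) (e-irr ∘ suc) xs rest i j

  realises⇒induced-copy : ∀ {k} {e : Fin k → Fin k → Bool} e-sym e-irr (xs : Vec (Fin n) k) →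
                          Realises e xs → InducedCopy (Pattern.graph e e-sym e-irr) G
  realises⇒induced-copy e-sym e-irr xs r =
    lookup xs , realises⇒injective _ xs r , realises⇒⇔ _ e-sym e-irr xs r

module MaximumClique {n} (G : Graph n) (v : Fin n) (Q : Subset n)
                     (Q-max : IsMaxCliqueInNbhd G v Q) where

  Q⊆N : InNbhd G v Q
  Q⊆N = proj₁ Q-max

  Q-clique : IsClique G Q
  Q-clique = proj₁ (proj₂ Q-max)

  clique-exchange : ∀ A D → InNbhd G v A → IsClique G A →
                    (∀ a → a ∈ A → ∀ q → q ∈ Q → q ∉ D → E G a q) → ∣ A ∣ ≤ ∣ D ∣
  clique-exchange A D A⊆N A-clique A~Q-D = +-cancelʳ-≤ _ _ _ (begin
    ∣ A ∣ + ∣ Q ─ D ∣  ≡⟨ complete⇒∣p∪q∣≡∣p∣+∣q∣ G A~Q─D ⟨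
    ∣ A ∪ (Q ─ D) ∣    ≤⟨ proj₂ (proj₂ Q-max) _ K⊆N K-clique ⟩
    ∣ Q ∣              ≤⟨ ∣p∣≤∣q∣+∣p─q∣ Q D ⟩
    ∣ D ∣ + ∣ Q ─ D ∣  ∎)
    where
      open ≤-Reasoning
      A~Q─D : Complete G A (Q ─ D)
      A~Q─D a a∈A q q∈Q─D = Product.uncurry (A~Q-D a a∈A q) (x∈p─q⁻ Q D q∈Q─D)
      Q─D⊆Q : Q ─ D ⊆ Q
      Q─D⊆Q = p─q⊆p Q D
      K⊆N : InNbhd G v (A ∪ (Q ─ D))
      K⊆N = ∀∈-∪ A⊆N (λ x → Q⊆N x ∘ Q─D⊆Q)
      K-clique : IsClique G (A ∪ (Q ─ D))
      K-clique = ∪-clique G A-clique (λ x y x∈ y∈ → Q-clique x y (Q─D⊆Q x∈) (Q─D⊆Q y∈)) A~Q─D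

  has-non-neighbour-in-Q : ∀ r → E G v r → ∃[ q ] (q ∈ Q × ¬ E G r q)
  has-non-neighbour-in-Q r vr with any? (λ q → (q ∈? Q) ×-dec ¬? (E-dec G r q))
  ... | yes found = found
  ... | no  none  = ⊥-elim (1+n≰n (subst₂ _≤_ (∣⁅x⁆∣≡1 r) (∣⊥∣≡0 n)
                      (clique-exchange ⁅ r ⁆ ∅ (∀∈-⁅⁆ vr) (⁅⁆-clique G r) r~Q)))
    where
      r~Q : ∀ x → x ∈ ⁅ r ⁆ → ∀ q → q ∈ Q → q ∉ ∅ → E G x q
      r~Q = ∀∈-⁅⁆ λ q q∈Q _ → E-stable G r q λ ¬rq → none (q , q∈Q , ¬rq)

  no-edge-exchange : ∀ {a b q} → E G v a → E G v b → E G a b →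
                     (∀ y → y ∈ Q → y ≢ q → E G a y) → (∀ y → y ∈ Q → y ≢ q → E G b y) → ⊥
  no-edge-exchange {a} {b} {q} va vb ab a~Q-q b~Q-q =
    1+n≰n (subst₂ _≤_ ∣A∣≡2 (∣⁅x⁆∣≡1 q) (clique-exchange A ⁅ q ⁆ A⊆N A-clique A~Q-q))
    where
      A : Subset n
      A = ⁅ a ⁆ ∪ ⁅ b ⁆
      a~b : Complete G ⁅ a ⁆ ⁅ b ⁆
      a~b = ∀∈-⁅⁆ (∀∈-⁅⁆ ab)
      ∣A∣≡2 : ∣ A ∣ ≡ 2
      ∣A∣≡2 = trans (complete⇒∣p∪q∣≡∣p∣+∣q∣ G a~b) (cong₂ _+_ (∣⁅x⁆∣≡1 a) (∣⁅x⁆∣≡1 b))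
      A⊆N : InNbhd G v A
      A⊆N = ∀∈-∪ (∀∈-⁅⁆ va) (∀∈-⁅⁆ vb)
      A-clique : IsClique G A
      A-clique = ∪-clique G (⁅⁆-clique G a) (⁅⁆-clique G b) a~b
      A~Q-q : ∀ x → x ∈ A → ∀ y → y ∈ Q → y ∉ ⁅ q ⁆ → E G x y
      A~Q-q = ∀∈-∪ (∀∈-⁅⁆ λ y y∈Q → a~Q-q y y∈Q ∘ x∉⁅y⁆⇒x≢y)
                   (∀∈-⁅⁆ λ y y∈Q → b~Q-q y y∈Q ∘ x∉⁅y⁆⇒x≢y)

  no-triangle-exchange : ∀ {a b c q₁ q₂} → E G v a → E G v b → E G v c →
                         E G a b → E G a c → E G b c →
                         (∀ y → y ∈ Q → y ≢ q₁ → y ≢ q₂ → E G a y) →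
                         (∀ y → y ∈ Q → y ≢ q₁ → y ≢ q₂ → E G b y) →
                         (∀ y → y ∈ Q → y ≢ q₁ → y ≢ q₂ → E G c y) → ⊥
  no-triangle-exchange {a} {b} {c} {q₁} {q₂} va vb vc ab ac bc a~Q-D b~Q-D c~Q-D =
    1+n≰n (≤-trans (subst (_≤ ∣ D ∣) ∣A∣≡3 (clique-exchange A D A⊆N A-clique A~Q-D))
                   (subst (∣ D ∣ ≤_) (cong₂ _+_ (∣⁅x⁆∣≡1 q₁) (∣⁅x⁆∣≡1 q₂))
                      (∣p∪q∣≤∣p∣+∣q∣ ⁅ q₁ ⁆ ⁅ q₂ ⁆)))
    where
      A D : Subset n
      A = ⁅ a ⁆ ∪ (⁅ b ⁆ ∪ ⁅ c ⁆)
      D = ⁅ q₁ ⁆ ∪ ⁅ q₂ ⁆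
      b~c : Complete G ⁅ b ⁆ ⁅ c ⁆
      b~c = ∀∈-⁅⁆ (∀∈-⁅⁆ bc)
      a~bc : Complete G ⁅ a ⁆ (⁅ b ⁆ ∪ ⁅ c ⁆)
      a~bc = ∀∈-⁅⁆ (∀∈-∪ (∀∈-⁅⁆ ab) (∀∈-⁅⁆ ac))
      ∣A∣≡3 : ∣ A ∣ ≡ 3
      ∣A∣≡3 = trans (complete⇒∣p∪q∣≡∣p∣+∣q∣ G a~bc)
                (cong₂ _+_ (∣⁅x⁆∣≡1 a) (trans (complete⇒∣p∪q∣≡∣p∣+∣q∣ G b~c)
                                             (cong₂ _+_ (∣⁅x⁆∣≡1 b) (∣⁅x⁆∣≡1 c))))
      A⊆N : InNbhd G v A
      A⊆N = ∀∈-∪ (∀∈-⁅⁆ va) (∀∈-∪ (∀∈-⁅⁆ vb) (∀∈-⁅⁆ vc))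
      A-clique : IsClique G A
      A-clique = ∪-clique G (⁅⁆-clique G a) (∪-clique G (⁅⁆-clique G b) (⁅⁆-clique G c) b~c) a~bc
      off-D : ∀ {x} → (∀ y → y ∈ Q → y ≢ q₁ → y ≢ q₂ → E G x y) → ∀ y → y ∈ Q → y ∉ D → E G x y
      off-D x~Q-D y y∈Q y∉D =
        x~Q-D y y∈Q (x∉⁅y⁆⇒x≢y (y∉D ∘ x∈p∪q⁺ ∘ inj₁)) (x∉⁅y⁆⇒x≢y (y∉D ∘ x∈p∪q⁺ ∘ inj₂))
      A~Q-D : ∀ x → x ∈ A → ∀ y → y ∈ Q → y ∉ D → E G x y
      A~Q-D = ∀∈-∪ (∀∈-⁅⁆ (off-D a~Q-D)) (∀∈-∪ (∀∈-⁅⁆ (off-D b~Q-D)) (∀∈-⁅⁆ (off-D c~Q-D)))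

module Neighbourhood {n} (G : Graph n) (free : ClawH1H2Free G) (v : Fin n) (Q : Subset n)
                     (Q-max : IsMaxCliqueInNbhd G v Q) where
  open MaximumClique G v Q Q-max

  Rest : Fin n → Set
  Rest = InRest G v Q

  rest? : ∀ x → Dec (Rest x)
  rest? x = E-dec G v x ×-dec ¬? (x ∈? Q)

  rest≢Q : ∀ {r q} → Rest r → q ∈ Q → r ≢ q
  rest≢Q (_ , r∉Q) q∈Q refl = r∉Q q∈Q

  non-neighbours-adjacent : ∀ {x y z} → E G v x → E G v y → E G v z → x ≢ y → x ≢ z → y ≢ z →
                            ¬ E G x y → ¬ E G x z → E G y z
  non-neighbours-adjacent {x} {y} {z} vx vy vz x≢y x≢z y≢z ¬xy ¬xz = E-stable G y z λ ¬yz →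
    proj₁ free (realises⇒induced-copy G clawSym clawIrr (v ∷ x ∷ y ∷ z ∷ [])
      ((vx , vy , vz , tt) , ((¬xy , x≢y) , (¬xz , x≢z) , tt) , ((¬yz , y≢z) , tt) , tt , tt))

  record AntiEdge (w z w′ z′ : Fin n) : Set where
    field
      w∈R  : Rest w
      z∈R  : Rest z
      w≢z  : w ≢ z
      ¬wz  : ¬ E G w z
      w′∈Q : w′ ∈ Q
      z′∈Q : z′ ∈ Q
      ¬ww′ : ¬ E G w w′
      ¬zz′ : ¬ E G z z′

  swap : ∀ {w z w′ z′} → AntiEdge w z w′ z′ → AntiEdge z w z′ w′
  swap e = record { w∈R = z∈R ; z∈R = w∈R ; w≢z = w≢z ∘ sym ; ¬wz = ¬wz ∘ E-sym G
                  ; w′∈Q = z′∈Q ; z′∈Q = w′∈Q ; ¬ww′ = ¬zz′ ; ¬zz′ = ¬ww′ }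
    where open AntiEdge e

  z~w′ : ∀ {w z w′ z′} → AntiEdge w z w′ z′ → E G z w′
  z~w′ e = non-neighbours-adjacent (proj₁ w∈R) (proj₁ z∈R) (Q⊆N _ w′∈Q)
             w≢z (rest≢Q w∈R w′∈Q) (rest≢Q z∈R w′∈Q) ¬wz ¬ww′
    where open AntiEdge e

  w′≢z′ : ∀ {w z w′ z′} → AntiEdge w z w′ z′ → w′ ≢ z′
  w′≢z′ e refl = AntiEdge.¬zz′ e (z~w′ e)

  common-neighbour-adjacent : ∀ {w z w′ z′} → AntiEdge w z w′ z′ →
                              ∀ {b} → E G b w′ → E G b z′ → E G b z → E G b w
  common-neighbour-adjacent {w} {z} {w′} {z′} e {b} bw′ bz′ bz = E-stable G b w λ ¬bw →
    proj₁ (proj₂ free) (realises⇒induced-copy G h1Sym h1Irr (w′ ∷ b ∷ z′ ∷ z ∷ w ∷ [])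
      ( (E-sym G bw′ , Q-clique w′ z′ w′∈Q z′∈Q (w′≢z′ e) , E-sym G (z~w′ e)
        , (¬ww′ ∘ E-sym G , rest≢Q w∈R w′∈Q ∘ sym) , tt)
      , (bz′ , bz , (¬bw , λ { refl → ¬ww′ bw′ }) , tt)
      , ((¬zz′ ∘ E-sym G , rest≢Q z∈R z′∈Q ∘ sym) , E-sym G (z~w′ (swap e)) , tt)
      , ((¬wz ∘ E-sym G , w≢z ∘ sym) , tt)
      , tt , tt))
    where open AntiEdge e

  unique-non-neighbour : ∀ {w z w′ z′} → AntiEdge w z w′ z′ → ∀ q → q ∈ Q → q ≢ w′ → E G w q
  unique-non-neighbour {w} {z} {w′} {z′} e q q∈Q q≢w′ = E-stable G w q λ ¬wq →
    let zq : E G z q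
        zq = z~w′ (record { w∈R = w∈R ; z∈R = z∈R ; w≢z = w≢z ; ¬wz = ¬wz
                           ; w′∈Q = q∈Q ; z′∈Q = z′∈Q ; ¬ww′ = ¬wq ; ¬zz′ = ¬zz′ })
        q≢z′ : q ≢ z′
        q≢z′ = λ { refl → ¬zz′ zq }
    in ¬wq (E-sym G (common-neighbour-adjacent e
         (Q-clique q w′ q∈Q w′∈Q q≢w′) (Q-clique q z′ q∈Q z′∈Q q≢z′) (E-sym G zq)))
    where open AntiEdge e

  Third : Fin n → Fin n → Fin n → Set
  Third w z r = Rest r × r ≢ w × r ≢ z

  third-swap : ∀ {w z r} → Third w z r → Third z w r
  third-swap (r∈R , r≢w , r≢z) = r∈R , r≢z , r≢w

  third-adjacent : ∀ {w z w′ z′ r} → AntiEdge w z w′ z′ → Third w z r → E G r w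
  third-adjacent {w} {z} {w′} {z′} {r} e (r∈R , r≢w , r≢z) = E-stable G r w λ ¬rw →
    let rz : E G r z
        rz = non-neighbours-adjacent (proj₁ w∈R) (proj₁ r∈R) (proj₁ z∈R)
               (r≢w ∘ sym) w≢z r≢z (¬rw ∘ E-sym G) ¬wz
        (r′ , r′∈Q , ¬rr′) = has-non-neighbour-in-Q r (proj₁ r∈R)
        e′ : AntiEdge r w r′ w′
        e′ = record { w∈R = r∈R ; z∈R = w∈R ; w≢z = r≢w ; ¬wz = ¬rw
                    ; w′∈Q = r′∈Q ; z′∈Q = w′∈Q ; ¬ww′ = ¬rr′ ; ¬zz′ = ¬ww′ }
    in case r′ ≟ z′ of λ where
         (yes refl) → no-edge-exchange (proj₁ z∈R) (proj₁ r∈R) (E-sym G rz)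
                        (unique-non-neighbour (swap e)) (unique-non-neighbour e′)
         (no r′≢z′) → ¬rw (common-neighbour-adjacent e (z~w′ (swap e′))
                        (unique-non-neighbour e′ z′ z′∈Q (r′≢z′ ∘ sym)) rz)
    where open AntiEdge e

  misses-Q⇒misses-z′ : ∀ {w z w′ z′ r q} → AntiEdge w z w′ z′ → Third w z r →
                       q ∈ Q → q ≢ w′ → q ≢ z′ → ¬ E G r q → ¬ E G r z′
  misses-Q⇒misses-z′ {w} {z} {w′} {z′} {r} {q} e r-third@(r∈R , _) q∈Q q≢w′ q≢z′ ¬rq rz′ =
    proj₂ (proj₂ free) (realises⇒induced-copy G h2Sym h2Irr (w ∷ z ∷ z′ ∷ r ∷ q ∷ [])
      ( ((¬wz , w≢z) , z~w′ (swap e) , E-sym G (third-adjacent e r-third)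
        , unique-non-neighbour e q q∈Q q≢w′ , tt)
      , ((¬zz′ , rest≢Q z∈R z′∈Q) , E-sym G (third-adjacent (swap e) (third-swap r-third))
        , unique-non-neighbour (swap e) q q∈Q q≢z′ , tt)
      , (E-sym G rz′ , Q-clique z′ q z′∈Q q∈Q (q≢z′ ∘ sym) , tt)
      , ((¬rq , rest≢Q r∈R q∈Q) , tt)
      , tt , tt))
    where open AntiEdge e

  third-adjacent-to-Q : ∀ {w z w′ z′ r} → AntiEdge w z w′ z′ → Third w z r →
                        ∀ q → q ∈ Q → q ≢ w′ → q ≢ z′ → E G r q
  third-adjacent-to-Q {w} {z} {w′} {z′} {r} e r-third@(r∈R , _) q q∈Q q≢w′ q≢z′ =
    E-stable G r q λ ¬rq →
      let ¬rz′ = misses-Q⇒misses-z′ e r-third q∈Q q≢w′ q≢z′ ¬rq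
          ¬rw′ = misses-Q⇒misses-z′ (swap e) (third-swap r-third) q∈Q q≢z′ q≢w′ ¬rq
      in proj₁ (proj₂ free) (realises⇒induced-copy G h1Sym h1Irr (z′ ∷ q ∷ w ∷ w′ ∷ r ∷ [])
        ( (Q-clique z′ q z′∈Q q∈Q (q≢z′ ∘ sym) , E-sym G (z~w′ (swap e))
          , Q-clique z′ w′ z′∈Q w′∈Q (w′≢z′ e ∘ sym)
          , (¬rz′ ∘ E-sym G , rest≢Q r∈R z′∈Q ∘ sym) , tt)
        , (E-sym G (unique-non-neighbour e q q∈Q q≢w′) , Q-clique q w′ q∈Q w′∈Q q≢w′
          , (¬rq ∘ E-sym G , rest≢Q r∈R q∈Q ∘ sym) , tt)
        , ((¬ww′ , rest≢Q w∈R w′∈Q) , E-sym G (third-adjacent e r-third) , tt)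
        , ((¬rw′ ∘ E-sym G , rest≢Q r∈R w′∈Q ∘ sym) , tt)
        , tt , tt))
    where open AntiEdge e

  third-misses-w′ : ∀ {w z w′ z′ r} → AntiEdge w z w′ z′ → Third w z r → ¬ E G r w′
  third-misses-w′ {w} {z} {w′} {z′} {r} e r-third@(r∈R , _) rw′ = case E-dec G r z′ of λ where
      (yes rz′) → let (q , q∈Q , ¬rq) = has-non-neighbour-in-Q r (proj₁ r∈R)
                  in ¬rq (case q ≟ z′ of λ where
                            (yes refl)  → rz′
                            (no  q≢z′) → r~Q-z′ q q∈Q q≢z′)
      (no ¬rz′) → no-edge-exchange (proj₁ r∈R) (proj₁ z∈R)
                    (third-adjacent (swap e) (third-swap r-third))
                    r~Q-z′ (unique-non-neighbour (swap e))
    where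
      open AntiEdge e
      r~Q-z′ : ∀ y → y ∈ Q → y ≢ z′ → E G r y
      r~Q-z′ y y∈Q y≢z′ = case y ≟ w′ of λ where
        (yes refl)  → rw′
        (no  y≢w′) → third-adjacent-to-Q e r-third y y∈Q y≢w′ y≢z′

  at-most-one-third : ∀ {w z w′ z′ r s} → AntiEdge w z w′ z′ → Third w z r → Third w z s → r ≢ s → ⊥
  at-most-one-third {w} {z} {w′} {z′} {r} {s} e r-third@(r∈R , _) s-third@(s∈R , _) r≢s =
    no-triangle-exchange (proj₁ w∈R) (proj₁ r∈R) (proj₁ s∈R)
      (E-sym G (third-adjacent e r-third)) (E-sym G (third-adjacent e s-third)) rs
      (λ y y∈Q y≢w′ _ → unique-non-neighbour e y y∈Q y≢w′)
      (third-adjacent-to-Q e r-third) (third-adjacent-to-Q e s-third)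
    where
      open AntiEdge e
      rs : E G r s
      rs = non-neighbours-adjacent (Q⊆N w′ w′∈Q) (proj₁ r∈R) (proj₁ s∈R)
             (rest≢Q r∈R w′∈Q ∘ sym) (rest≢Q s∈R w′∈Q ∘ sym) r≢s
             (third-misses-w′ e r-third ∘ E-sym G) (third-misses-w′ e s-third ∘ E-sym G)

  anti-edge? : Dec (∃[ x ] ∃[ y ] (Rest x × Rest y × x ≢ y × ¬ E G x y))
  anti-edge? = any? λ x → any? λ y → rest? x ×-dec rest? y ×-dec ¬? (x ≟ y) ×-dec ¬? (E-dec G x y)

  third? : ∀ w z → Dec (∃[ x ] Third w z x)
  third? w z = any? λ x → rest? x ×-dec ¬? (x ≟ w) ×-dec ¬? (x ≟ z)

  rest⇔pair : ∀ {w z} → Rest w → Rest z → ¬ (∃[ x ] Third w z x) → ∀ u → Rest u ⇔ (u ≡ w ⊎ u ≡ z)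
  rest⇔pair {w} {z} w∈R z∈R no-third u =
    mk⇔ (classify (u ≟ w) (u ≟ z)) λ { (inj₁ refl) → w∈R ; (inj₂ refl) → z∈R }
    where
      classify : Dec (u ≡ w) → Dec (u ≡ z) → Rest u → u ≡ w ⊎ u ≡ z
      classify (yes u≡w) _         _   = inj₁ u≡w
      classify (no  _)   (yes u≡z) _   = inj₂ u≡z
      classify (no  u≢w) (no  u≢z) u∈R = ⊥-elim (no-third (u , u∈R , u≢w , u≢z))

  rest⇔triple : ∀ {w z w′ z′ x} → AntiEdge w z w′ z′ → Third w z x →
                ∀ u → Rest u ⇔ (u ≡ w ⊎ u ≡ z ⊎ u ≡ x)
  rest⇔triple {w} {z} {x = x} e x-third u =
    mk⇔ (classify (u ≟ w) (u ≟ z) (u ≟ x))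
        λ { (inj₁ refl) → w∈R ; (inj₂ (inj₁ refl)) → z∈R ; (inj₂ (inj₂ refl)) → proj₁ x-third }
    where
      open AntiEdge e
      classify : Dec (u ≡ w) → Dec (u ≡ z) → Dec (u ≡ x) → Rest u → u ≡ w ⊎ u ≡ z ⊎ u ≡ x
      classify (yes u≡w) _         _         _   = inj₁ u≡w
      classify (no  _)   (yes u≡z) _         _   = inj₂ (inj₁ u≡z)
      classify (no  _)   (no  _)   (yes u≡x) _   = inj₂ (inj₂ u≡x)
      classify (no  u≢w) (no  u≢z) (no  u≢x) u∈R =
        ⊥-elim (at-most-one-third e (u∈R , u≢w , u≢z) x-third u≢x)

lemma1 : ∀ {n} (G : Graph n) → ClawH1H2Free G → (v : Fin n) (Q : Subset n) →
    IsMaxCliqueInNbhd G v Q →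
    (∀ x y → InRest G v Q x → InRest G v Q y → x ≢ y → E G x y)
    ⊎
    (∃[ w ] ∃[ z ] (w ≢ z × (∀ u → InRest G v Q u ⇔ (u ≡ w ⊎ u ≡ z)) × ¬ E G w z ×
      ∃[ w′ ] ∃[ z′ ] (w′ ∈ Q × z′ ∈ Q × ¬ E G w w′ × ¬ E G z z′ ×
        (∀ q → q ∈ Q → q ≢ z′ → E G z q) ×
        (∀ q → q ∈ Q → q ≢ w′ → E G w q))))
    ⊎
    (∃[ w ] ∃[ z ] ∃[ x ] (w ≢ z × x ≢ w × x ≢ z ×
      (∀ u → InRest G v Q u ⇔ (u ≡ w ⊎ u ≡ z ⊎ u ≡ x)) ×
      E G x z × E G x w × ¬ E G w z ×
      ∃[ w′ ] ∃[ z′ ] (w′ ∈ Q × z′ ∈ Q ×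
        ¬ E G w w′ × ¬ E G z z′ × ¬ E G x w′ × ¬ E G x z′ ×
        (∀ q → q ∈ Q → q ≢ w′ → E G w q) ×
        (∀ q → q ∈ Q → q ≢ z′ → E G z q) ×
        (∀ q → q ∈ Q → q ≢ w′ → q ≢ z′ → E G x q))))
lemma1 G free v Q Q-max = case anti-edge? of λ where
    (no no-anti-edge) → inj₁ λ x y x∈R y∈R x≢y →
      E-stable G x y λ ¬xy → no-anti-edge (x , y , x∈R , y∈R , x≢y , ¬xy)
    (yes (w , z , w∈R , z∈R , w≢z , ¬wz)) →
      let (w′ , w′∈Q , ¬ww′) = has-non-neighbour-in-Q w (proj₁ w∈R)
          (z′ , z′∈Q , ¬zz′) = has-non-neighbour-in-Q z (proj₁ z∈R)
          e : AntiEdge w z w′ z′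
          e = record { w∈R = w∈R ; z∈R = z∈R ; w≢z = w≢z ; ¬wz = ¬wz
                     ; w′∈Q = w′∈Q ; z′∈Q = z′∈Q ; ¬ww′ = ¬ww′ ; ¬zz′ = ¬zz′ }
      in case third? w z of λ where
        (no no-third) → inj₂ (inj₁ (w , z , w≢z , rest⇔pair w∈R z∈R no-third , ¬wz ,
          w′ , z′ , w′∈Q , z′∈Q , ¬ww′ , ¬zz′ ,
          unique-non-neighbour (swap e) , unique-non-neighbour e))
        (yes (x , x-third@(_ , x≢w , x≢z))) → inj₂ (inj₂ (w , z , x , w≢z , x≢w , x≢z ,
          rest⇔triple e x-third ,
          third-adjacent (swap e) (third-swap x-third) , third-adjacent e x-third , ¬wz ,
          w′ , z′ , w′∈Q , z′∈Q , ¬ww′ , ¬zz′ ,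
          third-misses-w′ e x-third , third-misses-w′ (swap e) (third-swap x-third) ,
          unique-non-neighbour e , unique-non-neighbour (swap e) ,
          third-adjacent-to-Q e x-third))
  where
    open MaximumClique G v Q Q-max
    open Neighbourhood G free v Q Q-max
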